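{- Let $n \geq 1$, let $\Pi \subseteq S_n$ be admissible and shift restricted, and let $m > n$. If $u, v$ are vertices of $G_m(\Pi)$ with an arc $u \to v$ and $\alpha(u) \neq \alpha(v)$, then there is a unique directed walk of length $n$ from $v$ to $u$.
   Context: Word graphs: for $\Pi \subseteq S_n$, $m > n$ and a set $B$ with $|B| = m$, the word graph $G_m = G_m(\Pi)$ is the directed graph whose vertices are the words $x_1 \dots x_n$ over $B$ with pairwise distinct letters, with arcs $x_1 x_2 \dots x_n \to x_2 \dots x_n y$ for every $y \in B\setminus\{x_1,\dots,x_n\}$ and $x_1 \dots x_n \to x_{\pi(1)} \dots x_{\pi(n)}$ for every $\pi \in \Pi$. $\Pi$ is admissible if the directed diameter of $G_{4n}(\Pi)$ equals $n$; $\Pi$ is shift restricted if $\pi(i) \leq i+1$ for all $\pi \in \Pi$, $1 \leq i \leq n$. The alphabet of $v = x_1\dots x_n$ is $\alpha(v) = \{x_1,\dots,x_n\}$. -}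

module Defs where

open import Data.Nat using (ℕ; zero; suc; _≤_; _<_; _*_)
open import Data.Fin using (Fin; toℕ)
open import Data.Fin.Permutation using (Permutation′; _⟨$⟩ʳ_)
open import Data.Vec using (Vec; []; _∷_; _∷ʳ_; lookup; tabulate; head; last; toList)
open import Data.Vec.Membership.Propositional using (_∈_)
open import Data.Product using (Σ; ∃; ∃-syntax; _×_; _,_)
open import Data.Sum using (_⊎_)
open import Data.Unit using (⊤)
open import Relation.Binary.PropositionalEquality using (_≡_)
open import Relation.Nullary using (¬_)

PermSet : ℕ → Set₁
PermSet n = Permutation′ n → Set

Word : ℕ → ℕ → Set
Word m n = Vec (Fin m) n

-- Vertices of G_m: words with pairwise distinct letters.
Distinct : ∀ {m n} → Word m n → Set
Distinct {n = n} w = ∀ (i j : Fin n) → lookup w i ≡ lookup w j → i ≡ j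

shift : ∀ {m n} → Word m n → Fin m → Word m n
shift [] y = []
shift (x ∷ xs) y = xs ∷ʳ y

-- x₁ … xₙ ↦ x_{π(1)} … x_{π(n)}  (0-indexed)
permute : ∀ {m n} → Permutation′ n → Word m n → Word m n
permute π w = tabulate (λ i → lookup w (π ⟨$⟩ʳ i))

Arc : ∀ {n} (Π : PermSet n) (m : ℕ) → Word m n → Word m n → Set
Arc Π m u v =
  Distinct u × Distinct v ×
  ((∃[ y ] (¬ (y ∈ u) × v ≡ shift u y)) ⊎
   (∃[ π ] (Π π × v ≡ permute π u)))

Chain : ∀ {n} (Π : PermSet n) (m : ℕ) {k : ℕ} → Vec (Word m n) k → Set
Chain Π m [] = ⊤
Chain Π m (u ∷ []) = ⊤
Chain Π m (u ∷ v ∷ ws) = Arc Π m u v × Chain Π m (v ∷ ws)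

IsWalk : ∀ {n} (Π : PermSet n) (m : ℕ) (ℓ : ℕ) → Word m n → Word m n
         → Vec (Word m n) (suc ℓ) → Set
IsWalk Π m ℓ a b ws = head ws ≡ a × last ws ≡ b × Chain Π m ws

WalkOfLength : ∀ {n} (Π : PermSet n) (m : ℕ) (ℓ : ℕ) → Word m n → Word m n → Set
WalkOfLength Π m ℓ a b = ∃[ ws ] IsWalk Π m ℓ a b ws

DiameterEq : ∀ {n} (Π : PermSet n) (m : ℕ) (d : ℕ) → Set
DiameterEq {n} Π m d =
  (∀ (u v : Word m n) → Distinct u → Distinct v →
     ∃[ ℓ ] (ℓ ≤ d × WalkOfLength Π m ℓ u v)) ×
  (∃[ u ] ∃[ v ] (Distinct u × Distinct v ×
     (∀ ℓ → ℓ < d → ¬ WalkOfLength Π m ℓ u v)))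

Admissible : ∀ {n} → PermSet n → Set
Admissible {n} Π = DiameterEq Π (4 * n) n

ShiftRestricted : ∀ {n} → PermSet n → Set
ShiftRestricted {n} Π = ∀ π → Π π → ∀ (i : Fin n) → toℕ (π ⟨$⟩ʳ i) ≤ suc (toℕ i)

-- The alphabet α(v) = {x₁,…,xₙ}, as a predicate on letters.
SameAlphabet : ∀ {m n} → Word m n → Word m n → Set
SameAlphabet {m} u v = ∀ (x : Fin m) → (x ∈ u → x ∈ v) × (x ∈ v → x ∈ u)

module Submission where

-- A permutation arc never changes the alphabet, so an arc u → v
-- with α(u) ≠ α(v) is a shift arc v = x₂ … xₙ y with y ∉ α(u).  From v the
-- word u = x₁ … xₙ is reached in n steps by shifting in x₁, …, xₙ in turn;
-- every letter shifted in is new at that moment, so this is a walk of length n.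
--
-- Uniqueness rests on shift restriction: along any arc a letter moves at most
-- one position to the left (or is shifted in at the last position).  Hence
-- in a walk of length n from v to u, the letter x₁ of u must already be
-- present after the first step; since it is absent from v, the first arc has
-- to be the shift by x₁.  Iterating this argument along the walk shows that
-- every walk of length n from v to u is the canonical one.

open import Defs
open import Data.Nat using (ℕ; suc; _≤_; _<_; _+_; s≤s; s≤s⁻¹)
open import Data.Nat.Properties
  using (≤-reflexive; ≤-trans; ≤-<-trans; <-irrefl; +-comm; +-suc; +-identityʳ; +-monoʳ-≤; n≤1+n; suc-injective)
open import Data.Fin using (Fin; zero; suc; toℕ)
open import Data.Fin.Properties using (toℕ-injective) renaming (suc-injective to fsuc-injective)
open import Data.Fin.Permutation using (Permutation′; _⟨$⟩ʳ_; _⟨$⟩ˡ_; inverseʳ)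
open import Data.List as List using (List; drop; _++_; [_])
open import Data.List.Properties using (++-assoc; ++-identityʳ)
open import Data.Vec using (Vec; []; _∷_; _∷ʳ_; lookup; head; last; toList)
open import Data.Vec.Properties using (lookup∘tabulate; toList-∷ʳ; toList-injective; length-toList; cast-is-id)
open import Data.Vec.Membership.Propositional using (_∈_)
open import Data.Vec.Membership.Propositional.Properties using (∈-lookup)
open import Data.Vec.Relation.Unary.Any using (here; there; index)
open import Data.Vec.Relation.Unary.Any.Properties using (lookup-index)
open import Data.Product using (∃-syntax; _×_; _,_; proj₂)
open import Data.Sum using (_⊎_; inj₁; inj₂; map₁)
open import Data.Empty using (⊥-elim)
open import Data.Unit using (⊤; tt)
open import Relation.Binary.PropositionalEquality using (_≡_; refl; sym; trans; cong; subst; subst₂; module ≡-Reasoning)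
open import Relation.Nullary using (¬_)

∈⇒lookup : ∀ {A : Set} {n} {x : A} {xs : Vec A n} → x ∈ xs → ∃[ i ] lookup xs i ≡ x
∈⇒lookup x∈xs = index x∈xs , sym (lookup-index x∈xs)

∈-∷ʳ⁻ : ∀ {A : Set} {n} {x y : A} (xs : Vec A n) → x ∈ xs ∷ʳ y → x ∈ xs ⊎ x ≡ y
∈-∷ʳ⁻ []       (here x≡y)  = inj₂ x≡y
∈-∷ʳ⁻ (z ∷ xs) (here x≡z)  = inj₁ (here x≡z)
∈-∷ʳ⁻ (z ∷ xs) (there x∈) = map₁ there (∈-∷ʳ⁻ xs x∈)

∈-shift⁻ : ∀ {m n} {x y : Fin m} (a : Word m n) → x ∈ shift a y → x ∈ a ⊎ x ≡ y
∈-shift⁻ (z ∷ a) x∈ = map₁ there (∈-∷ʳ⁻ a x∈)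

lookup-permute : ∀ {m n} (π : Permutation′ n) (a : Word m n) (i : Fin n) →
                 lookup (permute π a) i ≡ lookup a (π ⟨$⟩ʳ i)
lookup-permute π a = lookup∘tabulate (λ i → lookup a (π ⟨$⟩ʳ i))

permute-sameAlphabet : ∀ {m n} (π : Permutation′ n) (a : Word m n) → SameAlphabet a (permute π a)
permute-sameAlphabet π a x = into , outof
  where
  into : x ∈ a → x ∈ permute π a
  into x∈a with ∈⇒lookup x∈a
  ... | j , aj≡x = subst (_∈ permute π a) moved (∈-lookup (π ⟨$⟩ˡ j) (permute π a))
    where
    moved : lookup (permute π a) (π ⟨$⟩ˡ j) ≡ x
    moved = trans (lookup-permute π a (π ⟨$⟩ˡ j)) (trans (cong (lookup a) (inverseʳ π)) aj≡x)
  outof : x ∈ permute π a → x ∈ a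
  outof x∈πa with ∈⇒lookup x∈πa
  ... | j , πaj≡x = subst (_∈ a) (trans (sym (lookup-permute π a j)) πaj≡x) (∈-lookup (π ⟨$⟩ʳ j) a)

lookup-∷ʳ : ∀ {A : Set} {k} (xs : Vec A k) (y : A) (j : Fin (suc k)) →
            (∃[ i ] (toℕ i ≡ toℕ j × lookup (xs ∷ʳ y) j ≡ lookup xs i))
            ⊎ (toℕ j ≡ k × lookup (xs ∷ʳ y) j ≡ y)
lookup-∷ʳ []       y zero    = inj₂ (refl , refl)
lookup-∷ʳ (x ∷ xs) y zero    = inj₁ (zero , refl , refl)
lookup-∷ʳ (x ∷ xs) y (suc j) with lookup-∷ʳ xs y j
... | inj₁ (i , i≡j , eq) = inj₁ (suc i , cong suc i≡j , eq)
... | inj₂ (j≡k , eq)     = inj₂ (cong suc j≡k , eq)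

lookup-shift : ∀ {m k} (a : Word m (suc k)) (y : Fin m) (j : Fin (suc k)) →
               (∃[ i ] (toℕ i ≡ suc (toℕ j) × lookup (shift a y) j ≡ lookup a i))
               ⊎ (toℕ j ≡ k × lookup (shift a y) j ≡ y)
lookup-shift (x ∷ a) y j with lookup-∷ʳ a y j
... | inj₁ (i , i≡j , eq) = inj₁ (suc i , cong suc i≡j , eq)
... | inj₂ atLast        = inj₂ atLast

distinct-shift : ∀ {m k} {a : Word m (suc k)} {y : Fin m} → Distinct a → ¬ y ∈ a → Distinct (shift a y)
distinct-shift {a = a} {y} da y∉a i j eq with lookup-shift a y i | lookup-shift a y j
... | inj₁ (i′ , ti , ai) | inj₁ (j′ , tj , aj) =
      toℕ-injective (suc-injective (trans (sym ti) (trans (cong toℕ (da i′ j′ (trans (sym ai) (trans eq aj)))) tj)))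
... | inj₁ (i′ , _ , ai)  | inj₂ (_ , aj) = ⊥-elim (y∉a (subst (_∈ a) (trans (sym ai) (trans eq aj)) (∈-lookup i′ a)))
... | inj₂ (_ , ai)       | inj₁ (j′ , _ , aj) = ⊥-elim (y∉a (subst (_∈ a) (trans (sym aj) (trans (sym eq) ai)) (∈-lookup j′ a)))
... | inj₂ (ti , _)       | inj₂ (tj , _) = toℕ-injective (trans ti (sym tj))

shifts : ∀ {m n j} → Word m n → Vec (Fin m) j → Word m n
shifts a []       = a
shifts a (x ∷ xs) = shifts (shift a x) xs

shiftWalk : ∀ {m n j} → Word m n → Vec (Fin m) j → Vec (Word m n) (suc j)
shiftWalk a []       = a ∷ []
shiftWalk a (x ∷ xs) = a ∷ shiftWalk (shift a x) xs

head-shiftWalk : ∀ {m n j} (a : Word m n) (xs : Vec (Fin m) j) → head (shiftWalk a xs) ≡ a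
head-shiftWalk a []       = refl
head-shiftWalk a (x ∷ xs) = refl

last-shiftWalk : ∀ {m n j} (a : Word m n) (xs : Vec (Fin m) j) → last (shiftWalk a xs) ≡ shifts a xs
last-shiftWalk a []           = refl
last-shiftWalk a (x ∷ [])     = refl
last-shiftWalk a (x ∷ y ∷ xs) = last-shiftWalk (shift a x) (y ∷ xs)

Fresh : ∀ {m n j} → Word m n → Vec (Fin m) j → Set
Fresh a []       = ⊤
Fresh a (x ∷ xs) = ¬ x ∈ a × Fresh (shift a x) xs

shift-arc : ∀ {m k} (Π : PermSet (suc k)) {a : Word m (suc k)} {x : Fin m} →
            Distinct a → ¬ x ∈ a → Arc Π m a (shift a x)
shift-arc Π da x∉a = da , distinct-shift da x∉a , inj₁ (_ , x∉a , refl)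

shiftWalk-chain : ∀ {m k j} (Π : PermSet (suc k)) {a : Word m (suc k)} (xs : Vec (Fin m) j) →
                  Distinct a → Fresh a xs → Chain Π m (shiftWalk a xs)
shiftWalk-chain Π []           da tt = tt
shiftWalk-chain Π (x ∷ [])     da (x∉a , tt) = shift-arc Π da x∉a , tt
shiftWalk-chain Π (x ∷ y ∷ xs) da (x∉a , fresh) =
  shift-arc Π da x∉a , shiftWalk-chain Π (y ∷ xs) (distinct-shift da x∉a) fresh

toList-shifts : ∀ {m k j} (a : Word m (suc k)) (xs : Vec (Fin m) j) →
                toList (shifts a xs) ≡ drop j (toList a ++ toList xs)
toList-shifts a        []       = sym (++-identityʳ (toList a))
toList-shifts {j = suc j} (z ∷ a′) (x ∷ xs) = begin
  toList (shifts (a′ ∷ʳ x) xs)                ≡⟨ toList-shifts (a′ ∷ʳ x) xs ⟩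
  drop j (toList (a′ ∷ʳ x) ++ toList xs)      ≡⟨ cong (λ l → drop j (l ++ toList xs)) (toList-∷ʳ x a′) ⟩
  drop j ((toList a′ ++ [ x ]) ++ toList xs)  ≡⟨ cong (drop j) (++-assoc (toList a′) [ x ] (toList xs)) ⟩
  drop j (toList a′ ++ x List.∷ toList xs)    ∎
  where open ≡-Reasoning

drop-length-++ : ∀ {A : Set} (l r : List A) → drop (List.length l) (l ++ r) ≡ r
drop-length-++ List.[]      r = refl
drop-length-++ (x List.∷ l) r = drop-length-++ l r

shifts-fill : ∀ {m k} (a xs : Word m (suc k)) → shifts a xs ≡ xs
shifts-fill {k = k} a xs = trans (sym (cast-is-id refl (shifts a xs)))
  (toList-injective refl (shifts a xs) xs (begin
    toList (shifts a xs)                          ≡⟨ toList-shifts a xs ⟩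
    drop (suc k) (toList a ++ toList xs)          ≡⟨ cong (λ n → drop n (toList a ++ toList xs)) (sym (length-toList a)) ⟩
    drop (List.length (toList a)) (toList a ++ toList xs) ≡⟨ drop-length-++ (toList a) (toList xs) ⟩
    toList xs                                     ∎))
  where open ≡-Reasoning

-- Each letter xᵢ still to be shifted in occurs in a only strictly left of
-- position i; it is therefore shifted out before its turn comes.
OnlyBefore : ∀ {m n j} → Word m n → Vec (Fin m) j → Set
OnlyBefore a xs = ∀ i q → lookup a q ≡ lookup xs i → toℕ q < toℕ i

distinct-tail : ∀ {m j} {x : Fin m} {xs : Vec (Fin m) j} → Distinct (x ∷ xs) → Distinct xs
distinct-tail dxs i j eq = fsuc-injective (dxs (suc i) (suc j) eq)

-- Shifting in the first letter preserves the invariant for the remaining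
-- ones: old letters move one step left, and the new letter is none of them.
onlyBefore-shift : ∀ {m k j} {a : Word m (suc k)} {x : Fin m} {xs : Vec (Fin m) j} →
                   OnlyBefore a (x ∷ xs) → Distinct (x ∷ xs) → OnlyBefore (shift a x) xs
onlyBefore-shift {a = a} {x} before dxs i q eq with lookup-shift a x q
... | inj₁ (q′ , q′≡1+q , eq′) =
      s≤s⁻¹ (subst (_< suc (toℕ i)) q′≡1+q (before (suc i) q′ (trans (sym eq′) eq)))
... | inj₂ (_ , eq′) with dxs zero (suc i) (trans (sym eq′) eq)
... | ()

onlyBefore⇒fresh : ∀ {m k j} {a : Word m (suc k)} (xs : Vec (Fin m) j) →
                   OnlyBefore a xs → Distinct xs → Fresh a xs
onlyBefore⇒fresh []       _      _   = tt
onlyBefore⇒fresh {a = a} (x ∷ xs) before dxs =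
  x∉a , onlyBefore⇒fresh xs (onlyBefore-shift {a = a} before dxs) (distinct-tail dxs)
  where
  x∉a : ¬ x ∈ a
  x∉a x∈a with ∈⇒lookup x∈a
  ... | q , aq≡x with before zero q aq≡x
  ... | ()

-- After a new letter y is shifted into a vertex u, each letter uᵢ sits at
-- position i - 1, so the letters of u satisfy the invariant.
onlyBefore-afterShift : ∀ {m k} {u : Word m (suc k)} {y : Fin m} →
                        Distinct u → ¬ y ∈ u → OnlyBefore (shift u y) u
onlyBefore-afterShift {u = u} {y} du y∉u i q eq with lookup-shift u y q
... | inj₁ (q′ , q′≡1+q , eq′) = ≤-reflexive (trans (sym q′≡1+q) (cong toℕ (du q′ i (trans (sym eq′) eq))))
... | inj₂ (_ , eq′)          = ⊥-elim (y∉u (subst (_∈ u) (trans (sym eq) eq′) (∈-lookup i u)))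

arc-drift : ∀ {m k} {Π : PermSet (suc k)} → ShiftRestricted Π → {a a′ : Word m (suc k)} →
            Arc Π m a a′ → (q : Fin (suc k)) → toℕ q < k →
            ∃[ q′ ] (toℕ q′ ≤ suc (toℕ q) × lookup a q′ ≡ lookup a′ q)
arc-drift {k = k} sr {a} (_ , _ , inj₁ (y , _ , refl)) q q<k with lookup-shift a y q
... | inj₁ (q′ , q′≡1+q , eq) = q′ , ≤-reflexive q′≡1+q , sym eq
... | inj₂ (q≡k , _)          = ⊥-elim (<-irrefl refl (subst (_< k) q≡k q<k))
arc-drift sr {a} (_ , _ , inj₂ (π , π∈Π , refl)) q _ =
  π ⟨$⟩ʳ q , sr π π∈Π q , sym (lookup-permute π a q)

walk-drift : ∀ {m k ℓ} {Π : PermSet (suc k)} → ShiftRestricted Π →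
             (ws : Vec (Word m (suc k)) (suc ℓ)) → Chain Π m ws →
             (p : Fin (suc k)) → toℕ p + ℓ < suc k →
             ∃[ q ] (toℕ q ≤ toℕ p + ℓ × lookup (head ws) q ≡ lookup (last ws) p)
walk-drift sr (w ∷ []) _ p _ = p , ≤-reflexive (sym (+-identityʳ (toℕ p))) , refl
walk-drift {k = k} {ℓ = suc ℓ} sr (w ∷ w′ ∷ ws) (arc , chain) p bound
  with walk-drift sr (w′ ∷ ws) chain p (≤-trans (s≤s (+-monoʳ-≤ (toℕ p) (n≤1+n ℓ))) bound)
... | q₁ , q₁≤p+ℓ , eq₁ with arc-drift sr arc q₁ (≤-<-trans q₁≤p+ℓ p+ℓ<k)
  where
  p+ℓ<k : toℕ p + ℓ < k
  p+ℓ<k = s≤s⁻¹ (subst (_< suc k) (+-suc (toℕ p) ℓ) bound)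
... | q , q≤1+q₁ , eq =
  q , ≤-trans q≤1+q₁ (subst (suc (toℕ q₁) ≤_) (sym (+-suc (toℕ p) ℓ)) (s≤s q₁≤p+ℓ)) , trans eq eq₁

arc-introducing : ∀ {m n} {Π : PermSet n} {a a′ : Word m n} {x : Fin m} →
                  Arc Π m a a′ → ¬ x ∈ a → x ∈ a′ → a′ ≡ shift a x
arc-introducing {a = a} (_ , _ , inj₁ (y , _ , refl)) x∉a x∈a′ with ∈-shift⁻ a x∈a′
... | inj₁ x∈a = ⊥-elim (x∉a x∈a)
... | inj₂ refl = refl
arc-introducing {a = a} (_ , _ , inj₂ (π , _ , refl)) x∉a x∈a′ =
  ⊥-elim (x∉a (proj₂ (permute-sameAlphabet π a _) x∈a′))

-- Each letter xᵢ occurs in b at a position p with p + (j - 1 - i) < n: it is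
-- still visible in b after the j - 1 - i steps that follow its turn.
Visible : ∀ {m n j} → Word m n → Vec (Fin m) j → Set
Visible {n = n} {j} b xs = ∀ i → ∃[ p ] (lookup b p ≡ lookup xs i × toℕ p + j ≤ n + toℕ i)

visible-tail : ∀ {m n j} {b : Word m n} {x : Fin m} {xs : Vec (Fin m) j} →
               Visible b (x ∷ xs) → Visible b xs
visible-tail {n = n} {j} vis i with vis (suc i)
... | p , eq , bound = p , eq , s≤s⁻¹ (subst₂ _≤_ (+-suc (toℕ p) j) (+-suc n (toℕ i)) bound)

visible-self : ∀ {m n} (u : Word m n) → Visible u u
visible-self {n = n} u i = i , refl , ≤-reflexive (+-comm (toℕ i) n)

-- If fresh letters are visible in b, the shifting walk is the only walk of
-- its length from a to b: the first letter must enter in the first step.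
shiftWalk-unique : ∀ {m k j} {Π : PermSet (suc k)} → ShiftRestricted Π →
                   {a b : Word m (suc k)} (xs : Vec (Fin m) j) → Fresh a xs → Visible b xs →
                   (ws : Vec (Word m (suc k)) (suc j)) → IsWalk Π m j a b ws → ws ≡ shiftWalk a xs
shiftWalk-unique sr [] _ _ (w ∷ []) (refl , _ , _) = refl
shiftWalk-unique {k = k} {j = suc j} sr {a} {b} (x ∷ xs) (x∉a , fresh) vis
                 (w ∷ w′ ∷ ws) (refl , last≡b , arc , chain) =
  cong (a ∷_) (shiftWalk-unique sr xs fresh (visible-tail {b = b} vis) (w′ ∷ ws) (entersFirst , last≡b , chain))
  where
  entersFirst : w′ ≡ shift a x
  entersFirst with vis zero
  ... | p , bp≡x , bound
    with walk-drift sr (w′ ∷ ws) chain p (subst₂ _≤_ (+-suc (toℕ p) j) (+-identityʳ (suc k)) bound)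
  ... | q , _ , eq = arc-introducing arc x∉a
        (subst (_∈ w′) (trans eq (trans (cong (λ c → lookup c p) last≡b) bp≡x)) (∈-lookup q w′))

alphabetChanging-arc : ∀ {m n} {Π : PermSet n} {u v : Word m n} →
                       Arc Π m u v → ¬ SameAlphabet u v → ∃[ y ] (¬ y ∈ u × v ≡ shift u y)
alphabetChanging-arc (_ , _ , inj₁ shiftArc) _ = shiftArc
alphabetChanging-arc {u = u} (_ , _ , inj₂ (π , _ , refl)) changes =
  ⊥-elim (changes (permute-sameAlphabet π u))

mainTheorem14 : (n : ℕ) → 1 ≤ n → (Π : PermSet n) → Admissible Π → ShiftRestricted Π
    → (m : ℕ) → n < m → (u v : Word m n) → Arc Π m u v → ¬ SameAlphabet u v
    → ∃[ ws ] (IsWalk Π m n v u ws × (∀ ws′ → IsWalk Π m n v u ws′ → ws′ ≡ ws))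
mainTheorem14 (suc k) _ Π _ sr m _ u v arc@(du , dv , _) changes with alphabetChanging-arc arc changes
... | y , y∉u , refl = shiftWalk v u , isWalk , λ ws′ → shiftWalk-unique sr u fresh (visible-self u) ws′
  where
  fresh : Fresh v u
  fresh = onlyBefore⇒fresh u (onlyBefore-afterShift du y∉u) du

  isWalk : IsWalk Π m (suc k) v u (shiftWalk v u)
  isWalk = head-shiftWalk v u , trans (last-shiftWalk v u) (shifts-fill v u) , shiftWalk-chain Π u dv fresh
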